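{- Let $r>0$ be an integer. Consider words $w$ of length $2r$ in the four letters $E_+,E_-,B,B^\ast$ satisfying the following conditions: (i) every occurrence of $E_+$ is followed by $E_-$ or $B^\ast$; (ii) every occurrence of $E_-$ is followed by $E_+$ or $B$; (iii) every occurrence of $B$ is followed by $E_+$ or $B$; (iv) every occurrence of $B^\ast$ is followed by $E_-$ or $B^\ast$; (v) $E_+$ occurs in $w$ with the same multiplicity as $E_-$. Then there are exactly $2^{2r}$ such words.
   Context: Here "followed by" refers to the next letter in the word (for the last letter of the word no condition is imposed). -}

module Defs where

open import Data.Nat using (ℕ; zero; suc)
open import Data.Bool using (Bool; true; false; _∧_)
open import Data.List using (List; []; _∷_; concatMap; map; filterᵇ; length)
open import Data.Vec using (Vec; []; _∷_)
open import Data.Nat using (_≡ᵇ_)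

data Letter : Set where
  E₊ E₋ B B* : Letter

letters : List Letter
letters = E₊ ∷ E₋ ∷ B ∷ B* ∷ []

allWords : (n : ℕ) → List (Vec Letter n)
allWords zero    = [] ∷ []
allWords (suc n) = concatMap (λ x → map (x ∷_) (allWords n)) letters

follows : Letter → Letter → Bool
follows E₊ E₋ = true
follows E₊ B* = true
follows E₋ E₊ = true
follows E₋ B  = true
follows B  E₊ = true
follows B  B  = true
follows B* E₋ = true
follows B* B* = true
follows _  _  = false

adjacentOK : {n : ℕ} → Vec Letter n → Bool
adjacentOK []                = true
adjacentOK (x ∷ [])          = true
adjacentOK (x ∷ y ∷ w)       = follows x y ∧ adjacentOK (y ∷ w)

isE₊ : Letter → ℕ
isE₊ E₊ = 1
isE₊ _  = 0

isE₋ : Letter → ℕ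
isE₋ E₋ = 1
isE₋ _  = 0

countE₊ : {n : ℕ} → Vec Letter n → ℕ
countE₊ []      = 0
countE₊ (x ∷ w) = isE₊ x Data.Nat.+ countE₊ w

countE₋ : {n : ℕ} → Vec Letter n → ℕ
countE₋ []      = 0
countE₋ (x ∷ w) = isE₋ x Data.Nat.+ countE₋ w

admissible : {n : ℕ} → Vec Letter n → Bool
admissible w = adjacentOK w ∧ (countE₊ w ≡ᵇ countE₋ w)

numAdmissible : ℕ → ℕ
numAdmissible n = length (filterᵇ admissible (allWords n))

module Submission where

-- Call {E₊, B} (the successors of E₋ and of B) the plus letters and {E₋, B*} (the
-- successors of E₊ and of B*) the minus letters. Occurrences of E₊ and E₋ alternate, so
-- in a valid word starting with a plus letter #E₊ − #E₋ is 0 or 1, and in one starting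
-- with a minus letter it is 0 or −1. The last letter of a valid word can be exchanged for
-- the other letter of its class, which changes #E₊ − #E₋ by exactly one; hence of the
-- 2ⁿ⁺¹ valid words of length n + 1 starting in either class exactly 2ⁿ are balanced.
-- The count recurses on the first letter, with the balance condition shifted by offsets.

open import Defs
open import Data.Bool using (Bool; true; false; _∧_; if_then_else_; T?)
open import Data.Bool.Properties using (∧-assoc; ∧-comm)
open import Data.List using (List; []; _∷_; _++_; map; concatMap; filterᵇ; length)
open import Data.List.Properties using (filter-++; length-++; map-cong)
open import Data.Nat using (ℕ; zero; suc; _+_; _*_; _^_; _<_; _≡ᵇ_; _<ᵇ_)
open import Data.Nat.ListAction using (sum)
open import Data.Nat.Properties using (+-identityʳ; +-assoc; +-commutativeSemigroup)
open import Algebra.Properties.CommutativeSemigroup +-commutativeSemigroup using (x∙yz≈yx∙z; interchange)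
open import Data.Vec using (Vec; _∷_)
open import Function using (_∘_)
open import Relation.Binary.PropositionalEquality using (_≡_; _≗_; refl; sym; trans; cong; cong₂; module ≡-Reasoning)

private
  variable
    A C : Set

countᵇ : (A → Bool) → List A → ℕ
countᵇ p xs = length (filterᵇ p xs)

countᵇ-++ : (p : A → Bool) (xs ys : List A) → countᵇ p (xs ++ ys) ≡ countᵇ p xs + countᵇ p ys
countᵇ-++ p xs ys = trans (cong length (filter-++ (T? ∘ p) xs ys)) (length-++ (filterᵇ p xs))

countᵇ-concatMap : (p : C → Bool) (f : A → List C) (xs : List A) →
                   countᵇ p (concatMap f xs) ≡ sum (map (countᵇ p ∘ f) xs)
countᵇ-concatMap p f []       = refl
countᵇ-concatMap p f (x ∷ xs) =
  trans (countᵇ-++ p (f x) (concatMap f xs)) (cong (countᵇ p (f x) +_) (countᵇ-concatMap p f xs))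

countᵇ-map : (p : C → Bool) (f : A → C) (xs : List A) → countᵇ p (map f xs) ≡ countᵇ (p ∘ f) xs
countᵇ-map p f []       = refl
countᵇ-map p f (x ∷ xs) with p (f x)
... | true  = cong suc (countᵇ-map p f xs)
... | false = countᵇ-map p f xs

countᵇ-cong : {p q : A → Bool} → p ≗ q → countᵇ p ≗ countᵇ q
countᵇ-cong p≗q []       = refl
countᵇ-cong {q = q} p≗q (x ∷ xs) rewrite p≗q x with q x
... | true  = cong suc (countᵇ-cong p≗q xs)
... | false = countᵇ-cong p≗q xs

countᵇ-guard : (b : Bool) (p : A → Bool) (xs : List A) →
               countᵇ (λ x → b ∧ p x) xs ≡ (if b then countᵇ p xs else 0)
countᵇ-guard true  p xs = refl
countᵇ-guard false p []       = refl
countᵇ-guard false p (x ∷ xs) = countᵇ-guard false p xs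

numWords : (n : ℕ) → (Vec Letter n → Bool) → ℕ
numWords n p = countᵇ p (allWords n)

numWords-suc : (n : ℕ) (p : Vec Letter (suc n) → Bool) →
               numWords (suc n) p ≡ sum (map (λ x → numWords n (p ∘ (x ∷_))) letters)
numWords-suc n p = trans (countᵇ-concatMap p (λ x → map (x ∷_) (allWords n)) letters)
                         (cong sum (map-cong (λ x → countᵇ-map p (x ∷_) (allWords n)) letters))

validFrom : {n : ℕ} → Letter → ℕ → ℕ → Vec Letter n → Bool
validFrom x a b w = adjacentOK (x ∷ w) ∧ (a + countE₊ (x ∷ w) ≡ᵇ b + countE₋ (x ∷ w))

validFrom-∷ : {n : ℕ} (x y : Letter) (a b : ℕ) (w : Vec Letter n) →
              validFrom x a b (y ∷ w) ≡ follows x y ∧ validFrom y (isE₊ x + a) (isE₋ x + b) w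
validFrom-∷ x y a b w = begin
  (follows x y ∧ adjacentOK (y ∷ w)) ∧ (a + (isE₊ x + c₊) ≡ᵇ b + (isE₋ x + c₋))
    ≡⟨ ∧-assoc (follows x y) _ _ ⟩
  follows x y ∧ (adjacentOK (y ∷ w) ∧ (a + (isE₊ x + c₊) ≡ᵇ b + (isE₋ x + c₋)))
    ≡⟨ cong (λ e → follows x y ∧ (adjacentOK (y ∷ w) ∧ e))
            (cong₂ _≡ᵇ_ (x∙yz≈yx∙z a (isE₊ x) c₊) (x∙yz≈yx∙z b (isE₋ x) c₋)) ⟩
  follows x y ∧ validFrom y (isE₊ x + a) (isE₋ x + b) w
    ∎
  where
  open ≡-Reasoning
  c₊ c₋ : ℕ
  c₊ = countE₊ (y ∷ w)
  c₋ = countE₋ (y ∷ w)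

numValidFrom : ℕ → Letter → ℕ → ℕ → ℕ
numValidFrom n x a b = numWords n (validFrom x a b)

numValidFrom-suc : (n : ℕ) (x : Letter) (a b : ℕ) →
                   numValidFrom (suc n) x a b
                     ≡ sum (map (λ y → if follows x y then numValidFrom n y (isE₊ x + a) (isE₋ x + b) else 0) letters)
numValidFrom-suc n x a b = trans (numWords-suc n (validFrom x a b)) (cong sum (map-cong count-from letters))
  where
  count-from : (y : Letter) →
               numWords n (validFrom x a b ∘ (y ∷_))
                 ≡ (if follows x y then numValidFrom n y (isE₊ x + a) (isE₋ x + b) else 0)
  count-from y = trans (countᵇ-cong (validFrom-∷ x y a b) (allWords n))
                       (countᵇ-guard (follows x y) _ (allWords n))

fromPlus fromMinus : ℕ → ℕ → ℕ → ℕ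
fromPlus  n a b = numValidFrom n E₊ a b + numValidFrom n B  a b
fromMinus n a b = numValidFrom n E₋ a b + numValidFrom n B* a b

fromPlus-suc : (n a b : ℕ) → fromPlus (suc n) a b ≡ fromMinus n (suc a) b + fromPlus n a b
fromPlus-suc n a b =
  cong₂ _+_ (trans (numValidFrom-suc n E₊ a b) (cong (numValidFrom n E₋ (suc a) b +_) (+-identityʳ _)))
            (trans (numValidFrom-suc n B  a b) (cong (numValidFrom n E₊ a b +_) (+-identityʳ _)))

fromMinus-suc : (n a b : ℕ) → fromMinus (suc n) a b ≡ fromPlus n a (suc b) + fromMinus n a b
fromMinus-suc n a b =
  cong₂ _+_ (trans (numValidFrom-suc n E₋ a b) (cong (numValidFrom n E₊ a (suc b) +_) (+-identityʳ _)))
            (trans (numValidFrom-suc n B* a b) (cong (numValidFrom n E₋ a b +_) (+-identityʳ _)))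

within₁ : ℕ → ℕ → Bool
within₁ a b = (a <ᵇ suc b) ∧ (b <ᵇ suc (suc a))

within₁-suc : (a b : ℕ) → within₁ a (suc b) ≡ within₁ b a
within₁-suc a b = ∧-comm (a <ᵇ suc (suc b)) (b <ᵇ suc a)

fromPlus-zero : (a b : ℕ) → fromPlus 0 a b ≡ (if within₁ a b then 1 else 0)
fromPlus-zero zero    zero          = refl
fromPlus-zero zero    (suc zero)    = refl
fromPlus-zero zero    (suc (suc b)) = refl
fromPlus-zero (suc a) zero          = refl
fromPlus-zero (suc a) (suc b)       = fromPlus-zero a b

fromMinus-zero : (a b : ℕ) → fromMinus 0 a b ≡ (if within₁ b a then 1 else 0)
fromMinus-zero zero          zero    = refl
fromMinus-zero (suc zero)    zero    = refl
fromMinus-zero (suc (suc a)) zero    = refl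
fromMinus-zero zero          (suc b) = refl
fromMinus-zero (suc a)       (suc b) = fromMinus-zero a b

if-double : (c : Bool) (n : ℕ) →
            (if c then 2 ^ n else 0) + (if c then 2 ^ n else 0) ≡ (if c then 2 ^ suc n else 0)
if-double true  n = cong (2 ^ n +_) (sym (+-identityʳ (2 ^ n)))
if-double false n = refl

fromPlus-closed  : (n a b : ℕ) → fromPlus  n a b ≡ (if within₁ a b then 2 ^ n else 0)
fromMinus-closed : (n a b : ℕ) → fromMinus n a b ≡ (if within₁ b a then 2 ^ n else 0)

fromPlus-closed zero    a b = fromPlus-zero a b
fromPlus-closed (suc n) a b = begin
  fromPlus (suc n) a b                      ≡⟨ fromPlus-suc n a b ⟩
  fromMinus n (suc a) b + fromPlus n a b    ≡⟨ cong₂ _+_ (fromMinus-closed n (suc a) b) (fromPlus-closed n a b) ⟩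
  2^n-if (within₁ b (suc a)) + 2^n-if c     ≡⟨ cong (λ d → 2^n-if d + 2^n-if c) (within₁-suc b a) ⟩
  2^n-if c + 2^n-if c                       ≡⟨ if-double c n ⟩
  (if c then 2 ^ suc n else 0)              ∎
  where
  open ≡-Reasoning
  c : Bool
  c = within₁ a b
  2^n-if : Bool → ℕ
  2^n-if d = if d then 2 ^ n else 0

fromMinus-closed zero    a b = fromMinus-zero a b
fromMinus-closed (suc n) a b = begin
  fromMinus (suc n) a b                     ≡⟨ fromMinus-suc n a b ⟩
  fromPlus n a (suc b) + fromMinus n a b    ≡⟨ cong₂ _+_ (fromPlus-closed n a (suc b)) (fromMinus-closed n a b) ⟩
  2^n-if (within₁ a (suc b)) + 2^n-if c     ≡⟨ cong (λ d → 2^n-if d + 2^n-if c) (within₁-suc a b) ⟩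
  2^n-if c + 2^n-if c                       ≡⟨ if-double c n ⟩
  (if c then 2 ^ suc n else 0)              ∎
  where
  open ≡-Reasoning
  c : Bool
  c = within₁ b a
  2^n-if : Bool → ℕ
  2^n-if d = if d then 2 ^ n else 0

numAdmissible-suc : (n : ℕ) → numAdmissible (suc n) ≡ fromPlus n 0 0 + fromMinus n 0 0
numAdmissible-suc n = begin
  numAdmissible (suc n)                      ≡⟨ numWords-suc n admissible ⟩
  e₊ + (e₋ + (b + (b* + 0)))                 ≡⟨ cong (λ t → e₊ + (e₋ + (b + t))) (+-identityʳ b*) ⟩
  e₊ + (e₋ + (b + b*))                       ≡⟨ sym (+-assoc e₊ e₋ (b + b*)) ⟩
  (e₊ + e₋) + (b + b*)                       ≡⟨ interchange e₊ e₋ b b* ⟩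
  (e₊ + b) + (e₋ + b*)                       ∎
  where
  open ≡-Reasoning
  e₊ e₋ b b* : ℕ
  e₊ = numValidFrom n E₊ 0 0
  e₋ = numValidFrom n E₋ 0 0
  b  = numValidFrom n B  0 0
  b* = numValidFrom n B* 0 0

numAdmissible≡2^ : (n : ℕ) → numAdmissible n ≡ 2 ^ n
numAdmissible≡2^ zero    = refl
numAdmissible≡2^ (suc n) = begin
  numAdmissible (suc n)               ≡⟨ numAdmissible-suc n ⟩
  fromPlus n 0 0 + fromMinus n 0 0    ≡⟨ cong₂ _+_ (fromPlus-closed n 0 0) (fromMinus-closed n 0 0) ⟩
  2 ^ n + 2 ^ n                       ≡⟨ if-double true n ⟩
  2 ^ suc n                           ∎
  where open ≡-Reasoning

lemma2p1 : (r : ℕ) → 0 < r → numAdmissible (2 * r) ≡ 2 ^ (2 * r)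
-- The count is 2ⁿ for every length n.
lemma2p1 r _ = numAdmissible≡2^ (2 * r)
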